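{- For all integers $n\ge0$ and all integers $m$, $$\delta_n(m)=\delta_{n+1}^1(m)=\delta_{n+1}^2(m).$$
   Context: Let $A_0=\begin{pmatrix}1&0&1\\0&1&1\\0&0&1\end{pmatrix}$, $A_1=\begin{pmatrix}0&0&1\\1&0&1\\0&1&1\end{pmatrix}$, $A_2=\begin{pmatrix}0&1&1\\0&0&1\\1&0&1\end{pmatrix}$. For a tuple $J=(j_1,\dots,j_n)$ with $j_i\in\{0,1,2\}$ ($n\ge0$) set $(v_1(J),v_2(J),v_3(J))=(1,1,1)A_{j_1}\cdots A_{j_n}$; these numbers, over all $J$ of length $n$, are the level-$n$ terms of Stern's triatomic sequence. For an integer $m$, $\delta_n(m)$ is the number of pairs $(J,k)$ with $J$ of length $n$, $k\in\{1,2,3\}$ and $v_k(J)=m$; for fixed $k\in\{1,2,3\}$, $\delta_n^k(m)$ is the number of tuples $J$ of length $n$ with $v_k(J)=m$. -}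

module Defs where

open import Data.Nat using (ℕ; zero; suc; _+_)
open import Data.Integer using (ℤ; +_)
open import Data.Fin using (Fin; zero; suc)
open import Data.Vec using (Vec; []; _∷_; lookup)
open import Data.List using (List; []; _∷_; map; concatMap; length; filter; allFin)
open import Data.Product using (_×_; _,_)
open import Relation.Binary.PropositionalEquality using (_≡_)
import Data.Integer.Properties as ℤP

Mat : Set
Mat = Fin 3 → Fin 3 → ℕ

Row : Set
Row = Vec ℕ 3

mat : Vec (Vec ℕ 3) 3 → Mat
mat rows i j = lookup (lookup rows i) j

A : Fin 3 → Mat
A zero             = mat ((1 ∷ 0 ∷ 1 ∷ []) ∷ (0 ∷ 1 ∷ 1 ∷ []) ∷ (0 ∷ 0 ∷ 1 ∷ []) ∷ [])
A (suc zero)       = mat ((0 ∷ 0 ∷ 1 ∷ []) ∷ (1 ∷ 0 ∷ 1 ∷ []) ∷ (0 ∷ 1 ∷ 1 ∷ []) ∷ [])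
A (suc (suc zero)) = mat ((0 ∷ 1 ∷ 1 ∷ []) ∷ (0 ∷ 0 ∷ 1 ∷ []) ∷ (1 ∷ 0 ∷ 1 ∷ []) ∷ [])

_·_ : Row → Mat → Row
v · M = col zero ∷ col (suc zero) ∷ col (suc (suc zero)) ∷ []
  where
  col : Fin 3 → ℕ
  col j = lookup v zero * M zero j + lookup v (suc zero) * M (suc zero) j
          + lookup v (suc (suc zero)) * M (suc (suc zero)) j
    where open import Data.Nat using (_*_)

vecFrom : ∀ {n} → Row → Vec (Fin 3) n → Row
vecFrom v []      = v
vecFrom v (j ∷ J) = vecFrom (v · A j) J

v : ∀ {n} → Vec (Fin 3) n → Row
v J = vecFrom (1 ∷ 1 ∷ 1 ∷ []) J

tuples : (n : ℕ) → List (Vec (Fin 3) n)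
tuples zero    = [] ∷ []
tuples (suc n) = concatMap (λ j → map (j ∷_) (tuples n)) (allFin 3)

-- δ^k_n(m): number of J of length n with v_k(J) = m  (k ∈ Fin 3 : index 0 ↦ k = 1)
δᵏ : (n : ℕ) → Fin 3 → ℤ → ℕ
δᵏ n k m = length (filter (λ J → + lookup (v J) k ℤP.≟ m) (tuples n))

δ : ℕ → ℤ → ℕ
δ n m = δᵏ n zero m + δᵏ n (suc zero) m + δᵏ n (suc (suc zero)) m

-- Split a tuple of length n + 1 as J followed by its last letter j, so that
-- v(J j) = v(J) A_j.  The first column of A_j is the unit vector e_j and the
-- second column is e_{j+1 mod 3}; hence, as j runs over {0,1,2}, the first
-- (respectively second) entry of v(J j) runs over the three entries of v(J),
-- and counting the occurrences of m gives δ_n(m) in both cases.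
module Submission where

open import Defs
open import Data.Nat using (ℕ; suc; zero; _+_; _*_)
open import Data.Nat.Properties using (+-assoc; +-comm; +-identityʳ; +-commutativeSemigroup)
open import Algebra.Properties.CommutativeSemigroup +-commutativeSemigroup using (interchange)
open import Data.Nat.ListAction using (sum)
open import Data.Nat.ListAction.Properties using (sum-++)
open import Data.Nat.Tactic.RingSolver using (solve-∀)
open import Data.Integer using (ℤ)
import Data.Integer as ℤ
open import Data.Integer.Properties using (_≟_)
open import Data.Fin using (Fin; zero; suc)
open import Data.Vec using (Vec; []; _∷_; lookup)
open import Data.List using (List; []; _∷_; map; length; filter; _++_)
open import Data.List.Properties using (map-++; map-∘)
open import Data.Product using (_×_; _,_)
open import Data.Bool using (if_then_else_; true; false)
open import Function using (_∘_)
open import Relation.Nullary using (does)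
open import Relation.Unary using (Pred; Decidable)
open import Relation.Binary.PropositionalEquality
open ≡-Reasoning

length-filter≡sum-indicator : ∀ {a p} {X : Set a} {P : Pred X p} (P? : Decidable P) (xs : List X) →
  length (filter P? xs) ≡ sum (map (λ x → if does (P? x) then 1 else 0) xs)
length-filter≡sum-indicator P? [] = refl
length-filter≡sum-indicator P? (x ∷ xs) with does (P? x)
... | true  = cong suc (length-filter≡sum-indicator P? xs)
... | false = length-filter≡sum-indicator P? xs

sum-map-++ : ∀ {a} {X : Set a} (f : X → ℕ) (xs ys : List X) →
  sum (map f (xs ++ ys)) ≡ sum (map f xs) + sum (map f ys)
sum-map-++ f xs ys = trans (cong sum (map-++ f xs ys)) (sum-++ (map f xs) (map f ys))

Tuple : ℕ → Set
Tuple = Vec (Fin 3)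

∑ : (n : ℕ) → (Tuple n → ℕ) → ℕ
∑ zero    f = f []
∑ (suc n) f = ∑ n (f ∘ (zero ∷_)) + (∑ n (f ∘ (suc zero ∷_)) + ∑ n (f ∘ (suc (suc zero) ∷_)))

∑-cong : ∀ n {f g : Tuple n → ℕ} → f ≗ g → ∑ n f ≡ ∑ n g
∑-cong zero    f≗g = f≗g []
∑-cong (suc n) f≗g =
  cong₂ _+_ (∑-cong n (f≗g ∘ (zero ∷_)))
            (cong₂ _+_ (∑-cong n (f≗g ∘ (suc zero ∷_))) (∑-cong n (f≗g ∘ (suc (suc zero) ∷_))))

∑-+ : ∀ n (f g : Tuple n → ℕ) → ∑ n (λ J → f J + g J) ≡ ∑ n f + ∑ n g
∑-+ zero    f g = refl
∑-+ (suc n) f g = begin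
    ∑ n fg₀ + (∑ n fg₁ + ∑ n fg₂)
  ≡⟨ cong₂ _+_ (∑-+ n f₀ g₀) (cong₂ _+_ (∑-+ n f₁ g₁) (∑-+ n f₂ g₂)) ⟩
    (∑ n f₀ + ∑ n g₀) + ((∑ n f₁ + ∑ n g₁) + (∑ n f₂ + ∑ n g₂))
  ≡⟨ cong (∑ n f₀ + ∑ n g₀ +_) (interchange (∑ n f₁) _ _ _) ⟩
    (∑ n f₀ + ∑ n g₀) + ((∑ n f₁ + ∑ n f₂) + (∑ n g₁ + ∑ n g₂))
  ≡⟨ interchange (∑ n f₀) _ _ _ ⟩
    ∑ (suc n) f + ∑ (suc n) g
  ∎
  where
  f₀ f₁ f₂ g₀ g₁ g₂ fg₀ fg₁ fg₂ : Tuple n → ℕ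
  f₀ = f ∘ (zero ∷_)
  f₁ = f ∘ (suc zero ∷_)
  f₂ = f ∘ (suc (suc zero) ∷_)
  g₀ = g ∘ (zero ∷_)
  g₁ = g ∘ (suc zero ∷_)
  g₂ = g ∘ (suc (suc zero) ∷_)
  fg₀ J = f₀ J + g₀ J
  fg₁ J = f₁ J + g₁ J
  fg₂ J = f₂ J + g₂ J

sum-tuples≡∑ : ∀ n (f : Tuple n → ℕ) → sum (map f (tuples n)) ≡ ∑ n f
sum-tuples≡∑ zero    f = +-identityʳ (f [])
sum-tuples≡∑ (suc n) f = begin
    sum (map f (block zero ++ block (suc zero) ++ block (suc (suc zero)) ++ []))
  ≡⟨ sum-map-++ f (block zero) _ ⟩
    part zero + sum (map f (block (suc zero) ++ block (suc (suc zero)) ++ []))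
  ≡⟨ cong (part zero +_) (sum-map-++ f (block (suc zero)) _) ⟩
    part zero + (part (suc zero) + sum (map f (block (suc (suc zero)) ++ [])))
  ≡⟨ cong (λ s → part zero + (part (suc zero) + s))
          (trans (sum-map-++ f (block (suc (suc zero))) []) (+-identityʳ _)) ⟩
    part zero + (part (suc zero) + part (suc (suc zero)))
  ≡⟨ cong₂ _+_ (part≡∑ zero) (cong₂ _+_ (part≡∑ (suc zero)) (part≡∑ (suc (suc zero)))) ⟩
    ∑ (suc n) f
  ∎
  where
  block : Fin 3 → List (Tuple (suc n))
  block j = map (j ∷_) (tuples n)

  part : Fin 3 → ℕ
  part j = sum (map f (block j))

  part≡∑ : ∀ j → part j ≡ ∑ n (f ∘ (j ∷_))
  part≡∑ j = trans (cong sum (sym (map-∘ (tuples n)))) (sum-tuples≡∑ n (f ∘ (j ∷_)))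

successorSum : (Row → ℕ) → Row → ℕ
successorSum h r = h (r · A zero) + (h (r · A (suc zero)) + h (r · A (suc (suc zero))))

-- vecFrom consumes letters from the front, so the last letter is reached by
-- induction on n with the starting row w generalised.
∑-last-step : ∀ n (w : Row) (h : Row → ℕ) →
  ∑ (suc n) (h ∘ vecFrom w) ≡ ∑ n (successorSum h ∘ vecFrom w)
∑-last-step zero    w h = refl
∑-last-step (suc n) w h =
  cong₂ _+_ (∑-last-step n (w · A zero) h)
            (cong₂ _+_ (∑-last-step n (w · A (suc zero)) h) (∑-last-step n (w · A (suc (suc zero))) h))

hits : Fin 3 → ℤ → Row → ℕ
hits k m r = if does (ℤ.+ lookup r k ≟ m) then 1 else 0

hitsAny : ℤ → Row → ℕ
hitsAny m r = hits zero m r + (hits (suc zero) m r + hits (suc (suc zero)) m r)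

δᵏ≡∑ : ∀ n k m → δᵏ n k m ≡ ∑ n (hits k m ∘ v)
δᵏ≡∑ n k m = trans (length-filter≡sum-indicator (λ J → ℤ.+ lookup (v J) k ≟ m) (tuples n))
                   (sum-tuples≡∑ n (hits k m ∘ v))

δ≡∑ : ∀ n m → δ n m ≡ ∑ n (hitsAny m ∘ v)
δ≡∑ n m = begin
    δᵏ n zero m + δᵏ n (suc zero) m + δᵏ n (suc (suc zero)) m
  ≡⟨ +-assoc (δᵏ n zero m) _ _ ⟩
    δᵏ n zero m + (δᵏ n (suc zero) m + δᵏ n (suc (suc zero)) m)
  ≡⟨ cong₂ _+_ (δᵏ≡∑ n zero m) (cong₂ _+_ (δᵏ≡∑ n (suc zero) m) (δᵏ≡∑ n (suc (suc zero)) m)) ⟩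
    ∑ n (hits zero m ∘ v) + (∑ n (hits (suc zero) m ∘ v) + ∑ n (hits (suc (suc zero)) m ∘ v))
  ≡⟨ cong (∑ n (hits zero m ∘ v) +_) (sym (∑-+ n (hits (suc zero) m ∘ v) _)) ⟩
    ∑ n (hits zero m ∘ v) + ∑ n (λ J → hits (suc zero) m (v J) + hits (suc (suc zero)) m (v J))
  ≡⟨ sym (∑-+ n (hits zero m ∘ v) _) ⟩
    ∑ n (hitsAny m ∘ v)
  ∎

dot-e₁ : ∀ a b c → a * 1 + b * 0 + c * 0 ≡ a
dot-e₁ = solve-∀

dot-e₂ : ∀ a b c → a * 0 + b * 1 + c * 0 ≡ b
dot-e₂ = solve-∀

dot-e₃ : ∀ a b c → a * 0 + b * 0 + c * 1 ≡ c
dot-e₃ = solve-∀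

successorSum-hits₁ : ∀ m r → successorSum (hits zero m) r ≡ hitsAny m r
successorSum-hits₁ m (a ∷ b ∷ c ∷ []) rewrite dot-e₁ a b c | dot-e₂ a b c | dot-e₃ a b c = refl

successorSum-hits₂ : ∀ m r → successorSum (hits (suc zero) m) r ≡ hitsAny m r
successorSum-hits₂ m r@(a ∷ b ∷ c ∷ []) rewrite dot-e₁ a b c | dot-e₂ a b c | dot-e₃ a b c =
  trans (sym (+-assoc h₂ h₃ h₁)) (+-comm (h₂ + h₃) h₁)
  where
  h₁ h₂ h₃ : ℕ
  h₁ = hits zero m r
  h₂ = hits (suc zero) m r
  h₃ = hits (suc (suc zero)) m r

δᵏ-suc≡δ : ∀ n m k → (∀ r → successorSum (hits k m) r ≡ hitsAny m r) → δᵏ (suc n) k m ≡ δ n m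
δᵏ-suc≡δ n m k successorSum-hits = begin
    δᵏ (suc n) k m
  ≡⟨ δᵏ≡∑ (suc n) k m ⟩
    ∑ (suc n) (hits k m ∘ v)
  ≡⟨ ∑-last-step n (1 ∷ 1 ∷ 1 ∷ []) (hits k m) ⟩
    ∑ n (successorSum (hits k m) ∘ v)
  ≡⟨ ∑-cong n (successorSum-hits ∘ v) ⟩
    ∑ n (hitsAny m ∘ v)
  ≡⟨ sym (δ≡∑ n m) ⟩
    δ n m
  ∎

mainTheorem9 : (n : ℕ) (m : ℤ) →
    (δ n m ≡ δᵏ (suc n) zero m) × (δᵏ (suc n) zero m ≡ δᵏ (suc n) (suc zero) m)
mainTheorem9 n m = sym first , trans first (sym second)
  where
  first  : δᵏ (suc n) zero m ≡ δ n m
  second : δᵏ (suc n) (suc zero) m ≡ δ n m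
  first  = δᵏ-suc≡δ n m zero (successorSum-hits₁ m)
  second = δᵏ-suc≡δ n m (suc zero) (successorSum-hits₂ m)
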